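{- For every sequent $S$: if $S$ is provable in $\mathsf{G}^\infty$, then $S$ is provable in $\mathsf{G}^\infty_{\mathrm{slim}}$.
   Context: Formulas: $\phi ::= p \mid \bot \mid \phi\to\phi \mid \phi\rhd\phi$. A sequent $\Gamma\Rightarrow\Delta$ is a pair of finite multisets of formulas; commas denote multiset union; $\Sigma\rhd\bot := \{\sigma\rhd\bot:\sigma\in\Sigma\}$; for formulas $\phi_0,\dots,\phi_{m-1}$, $\Phi_{[0,i)} := \{\phi_0,\dots,\phi_{i-1}\}$. Rules: (ax) $p,\Gamma\Rightarrow p,\Delta$ for a variable $p$; ($\bot$L) $\bot,\Gamma\Rightarrow\Delta$; ($\bot$R) from $\Gamma\Rightarrow\Delta$ infer $\Gamma\Rightarrow\bot,\Delta$; ($\to$L) from $\Gamma\Rightarrow\Delta,\phi$ and $\psi,\Gamma\Rightarrow\Delta$ infer $\phi\to\psi,\Gamma\Rightarrow\Delta$; ($\to$R) from $\phi,\Gamma\Rightarrow\Delta,\psi$ infer $\Gamma\Rightarrow\Delta,\phi\to\psi$; ($\rhd_{\mathsf{IK4}}$) for $m\ge0$: from the premises $\psi_i,(\Phi_{[0,i)},\phi)\rhd\bot\Rightarrow\Phi_{[0,i)},\phi$ ($i=0,\dots,m$) infer $\phi_0\rhd\psi_0,\dots,\phi_{m-1}\rhd\psi_{m-1},\Gamma\Rightarrow\psi_m\rhd\phi,\Delta$; ($\rhd^{\mathrm{slim}}_{\mathsf{IK4}}$) the instances of $\rhd_{\mathsf{IK4}}$ in which $\phi_0,\dots,\phi_{m-1}$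 are pairwise distinct. $\mathsf{G}^\infty$ (resp. $\mathsf{G}^\infty_{\mathrm{slim}}$): a proof is a possibly infinite, finitely branching tree whose nodes are labelled with sequents and rules among ax, $\bot$L, $\bot$R, $\to$L, $\to$R and $\rhd_{\mathsf{IK4}}$ (resp. $\rhd^{\mathrm{slim}}_{\mathsf{IK4}}$), each node with its children being an instance of its rule (leaves are ax or $\bot$L), such that every infinite branch passes infinitely often from the conclusion of a modal-rule instance to one of its premises. -}

module Defs where

open import Data.Nat using (ℕ; suc)
open import Data.Fin using (Fin; toℕ; inject₁; fromℕ)
open import Data.List using (List; []; _∷_; _++_; map; take; allFin; tabulate)
open import Data.List.Relation.Binary.Permutation.Propositional using (_↭_)
open import Data.Unit using (⊤)
open import Data.Product using (Σ; _×_)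
open import Function.Definitions using (Injective)
open import Relation.Binary.PropositionalEquality using (_≡_)

infixr 6 _⇒ᶠ_
infixr 7 _▷_
data Fm : Set where
  var  : ℕ → Fm
  bot  : Fm
  _⇒ᶠ_ : Fm → Fm → Fm
  _▷_  : Fm → Fm → Fm

-- Finite multisets are represented by lists; every rule's conclusion is
-- matched only up to permutation (_↭_), so sequents are pairs of multisets.

_▷⊥ : List Fm → List Fm
Σ ▷⊥ = map (λ σ → σ ▷ bot) Σ

prefix : {m : ℕ} → (Fin m → Fm) → Fin (suc m) → List Fm
prefix {m} φ i = take (toℕ i) (tabulate φ)

data Calculus : Set where
  full slim : Calculus

SideCond : Calculus → {m : ℕ} → (Fin m → Fm) → Set
SideCond full φ = ⊤
SideCond slim φ = Injective _≡_ _≡_ φ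

-- A proof is a possibly
-- infinite tree; we present such trees coalgebraically (the greatest fixed
-- point  ν X. μ Y. (non-modal rules over Y + modal rule over X)):
-- `Local c X Γ Δ` is a FINITE (inductive) derivation of Γ ⇒ Δ using the
-- non-modal rules, whose leaves are ax / ⊥L, or modal-rule instances whose
-- premises are sequents in X.  A proof of Γ ⇒ Δ is a family X containing
-- Γ ⇒ Δ with every member of X having such a local derivation; unfolding gives
-- a finitely branching tree in which every infinite branch passes infinitely
-- often from a modal conclusion to one of its premises (and conversely every
-- such tree yields such an X, namely the set of its subtrees).
data Local (c : Calculus) (X : List Fm → List Fm → Set) : List Fm → List Fm → Set where
  ax   : ∀ {Γ Δ} Γ' Δ' (p : ℕ) →
         Γ ↭ (var p ∷ Γ') → Δ ↭ (var p ∷ Δ') → Local c X Γ Δ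
  botL : ∀ {Γ Δ} Γ' →
         Γ ↭ (bot ∷ Γ') → Local c X Γ Δ
  botR : ∀ {Γ Δ} Δ' →
         Δ ↭ (bot ∷ Δ') →
         Local c X Γ Δ' → Local c X Γ Δ
  impL : ∀ {Γ Δ} Γ' (φ ψ : Fm) →
         Γ ↭ ((φ ⇒ᶠ ψ) ∷ Γ') →
         Local c X Γ' (Δ ++ φ ∷ []) → Local c X (ψ ∷ Γ') Δ → Local c X Γ Δ
  impR : ∀ {Γ Δ} Δ' (φ ψ : Fm) →
         Δ ↭ (Δ' ++ (φ ⇒ᶠ ψ) ∷ []) →
         Local c X (φ ∷ Γ) (Δ' ++ ψ ∷ []) → Local c X Γ Δ
  modal : ∀ {Γ Δ} Γ' Δ' (m : ℕ) (φs : Fin m → Fm) (ψs : Fin (suc m) → Fm) (φ : Fm) →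
          SideCond c φs →
          Γ ↭ (map (λ j → φs j ▷ ψs (inject₁ j)) (allFin m) ++ Γ') →
          Δ ↭ ((ψs (fromℕ m) ▷ φ) ∷ Δ') →
          ((i : Fin (suc m)) →
             X (ψs i ∷ ((prefix φs i ++ φ ∷ []) ▷⊥)) (prefix φs i ++ φ ∷ [])) →
          Local c X Γ Δ

Provable : Calculus → List Fm → List Fm → Set₁
Provable c Γ Δ =
  Σ (List Fm → List Fm → Set) λ X →
    ((Γ' Δ' : List Fm) → X Γ' Δ' → Local c X Γ' Δ') × X Γ Δ

G∞⊢ : List Fm → List Fm → Set₁
G∞⊢ Γ Δ = Provable full Γ Δ

G∞slim⊢ : List Fm → List Fm → Set₁
G∞slim⊢ Γ Δ = Provable slim Γ Δ

-- We replay
-- these local derivations on the upward closure ↑ X of X under the covering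
-- preorder ≼: Γ₀ ⇒ Δ₀ ≼ Γ ⇒ Δ when every formula of Γ₀ ⇒ Δ₀ occurs on its side
-- of Γ ⇒ Δ or is decomposed by ⊥R, →L, →R into such formulas.  Inclusion alone
-- would not do, since →L and →R delete a principal formula that may occur
-- twice in the conclusion.  A sequent covering the conclusion of ⊥R, →L or →R
-- covers one of its premises or is the conclusion of an instance of the same
-- rule whose premises cover the old ones.  At a ▷_IK4 instance we keep, for
-- each formula among φ_0, …, φ_{m-1}, only the pair of its first occurrence:
-- every Φ_[0,i) of the resulting slim instance has the same elements as that
-- of the premise it replaces, so its premises cover premises in X.  Modal
-- steps are kept, so the progress condition is preserved.

module Submission where

open import Defs
open import Data.Empty using (⊥-elim)
open import Data.Fin using (Fin; zero; suc; inject₁; fromℕ)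
open import Data.List using (List; []; _∷_; _++_; map; allFin; tabulate; length; lookup)
open import Data.List.Membership.Propositional using (_∈_; _∉_)
open import Data.List.Membership.Propositional.Properties
  using (∈-∃++; ∈-++⁺ˡ; ∈-++⁺ʳ; ∈-++⁻; ∈-map⁻; ∈-lookup)
open import Data.List.Properties using (map-tabulate)
open import Data.List.Relation.Binary.Permutation.Propositional
  using (_↭_; ↭-refl; ↭-sym; ↭-trans; ↭-reflexive; prep)
open import Data.List.Relation.Binary.Permutation.Propositional.Properties
  using (∈-resp-↭; shift; ∷↭∷ʳ)
open import Data.List.Relation.Binary.Subset.Propositional using (_⊆_)
open import Data.List.Relation.Binary.Subset.Propositional.Properties
  using (⊆-reflexive-↭; ⊆∷∧∉⇒⊆; xs⊆x∷xs; xs⊆xs++ys; ∷⁺ʳ; ∈-∷⁺ʳ; ++⁺ˡ; map⁺)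
open import Data.List.Relation.Unary.All as All using (All)
open import Data.List.Relation.Unary.AllPairs as AllPairs using (AllPairs; []; _∷_)
import Data.List.Relation.Unary.AllPairs.Properties as AllPairsₚ
open import Data.List.Relation.Unary.Any using (here; there)
open import Data.List.Relation.Unary.Unique.Propositional using (Unique)
open import Data.List.Relation.Unary.Unique.Propositional.Properties using (Unique[x∷xs]⇒x∉xs)
open import Data.Nat using (ℕ; zero; suc)
import Data.Nat.Properties as ℕₚ
open import Data.Product using (_×_; _,_; proj₁; proj₂; ∃; ∃₂; uncurry)
open import Data.Sum using (inj₁; inj₂)
open import Function using (id; _∘_; _on_)
open import Function.Definitions using (Injective)
open import Level using (Level)
open import Relation.Binary.PropositionalEquality
  using (_≡_; _≢_; refl; sym; trans; cong)
open import Relation.Nullary using (Dec; yes; no)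
open import Relation.Nullary.Decidable using (map′; _×-dec_)

private
  variable
    ℓ : Level
    A : Set ℓ
    x : A
    xs ys zs : List A
    m : ℕ
    a b φ ψ χ : Fm
    Γ Δ Γ₀ Δ₀ Γ′ Δ′ G D : List Fm
    X Y : List Fm → List Fm → Set

∈⇒↭ : x ∈ xs → ∃ λ ys → xs ↭ x ∷ ys
∈⇒↭ {x = x} x∈xs with ys , zs , refl ← ∈-∃++ x∈xs = ys ++ zs , shift x ys zs

∈⇒↭∷ʳ : x ∈ xs → ∃ λ ys → xs ↭ ys ++ x ∷ []
∈⇒↭∷ʳ {x = x} x∈xs with ys , xs↭ ← ∈⇒↭ x∈xs = ys , ↭-trans xs↭ (∷↭∷ʳ x ys)

Unique-⊆⇒↭++ : Unique xs → xs ⊆ ys → ∃ λ zs → ys ↭ xs ++ zs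
Unique-⊆⇒↭++ {xs = []} {ys} [] _ = ys , ↭-refl
Unique-⊆⇒↭++ {xs = x ∷ xs} unique x∷xs⊆ys
  with ys′ , ys↭ ← ∈⇒↭ (x∷xs⊆ys (here refl))
  with zs , ys′↭ ← Unique-⊆⇒↭++ (AllPairs.tail unique)
                     (⊆∷∧∉⇒⊆ (⊆-reflexive-↭ ys↭ ∘ x∷xs⊆ys ∘ there) (Unique[x∷xs]⇒x∉xs unique))
  = zs , ↭-trans ys↭ (prep x ys′↭)

↭∷⇒⊇ : xs ↭ x ∷ ys → ys ⊆ xs
↭∷⇒⊇ xs↭ = ⊆-reflexive-↭ (↭-sym xs↭) ∘ there

↭++⇒⊇ : xs ↭ ys ++ zs → ys ⊆ xs
↭++⇒⊇ xs↭ = ⊆-reflexive-↭ (↭-sym xs↭) ∘ ∈-++⁺ˡ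

▷-injectiveˡ : a ▷ b ≡ φ ▷ ψ → a ≡ φ
▷-injectiveˡ refl = refl

infix 4 _≟_
_≟_ : (φ ψ : Fm) → Dec (φ ≡ ψ)
var m ≟ var n = map′ (cong var) (λ { refl → refl }) (m ℕₚ.≟ n)
bot ≟ bot = yes refl
(a ⇒ᶠ b) ≟ (φ ⇒ᶠ ψ) =
  map′ (λ { (refl , refl) → refl }) (λ { refl → refl , refl }) (a ≟ φ ×-dec b ≟ ψ)
(a ▷ b) ≟ (φ ▷ ψ) =
  map′ (λ { (refl , refl) → refl }) (λ { refl → refl , refl }) (a ≟ φ ×-dec b ≟ ψ)
var _ ≟ bot = no λ ()
var _ ≟ (_ ⇒ᶠ _) = no λ ()
var _ ≟ (_ ▷ _) = no λ ()
bot ≟ var _ = no λ ()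
bot ≟ (_ ⇒ᶠ _) = no λ ()
bot ≟ (_ ▷ _) = no λ ()
(_ ⇒ᶠ _) ≟ var _ = no λ ()
(_ ⇒ᶠ _) ≟ bot = no λ ()
(_ ⇒ᶠ _) ≟ (_ ▷ _) = no λ ()
(_ ▷ _) ≟ var _ = no λ ()
(_ ▷ _) ≟ bot = no λ ()
(_ ▷ _) ≟ (_ ⇒ᶠ _) = no λ ()

open import Data.List.Membership.DecPropositional _≟_ using (_∈?_)

mutual
  data CoveredL (Γ Δ : List Fm) : Fm → Set where
    ∈ˡ   : χ ∈ Γ → CoveredL Γ Δ χ
    ⇒ᶠˡ₁ : CoveredR Γ Δ a → CoveredL Γ Δ (a ⇒ᶠ b)
    ⇒ᶠˡ₂ : CoveredL Γ Δ b → CoveredL Γ Δ (a ⇒ᶠ b)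

  data CoveredR (Γ Δ : List Fm) : Fm → Set where
    ∈ʳ   : χ ∈ Δ → CoveredR Γ Δ χ
    botʳ : CoveredR Γ Δ bot
    ⇒ᶠʳ  : CoveredL Γ Δ a → CoveredR Γ Δ b → CoveredR Γ Δ (a ⇒ᶠ b)

infix 4 _⇒_≼_⇒_
record _⇒_≼_⇒_ (Γ₀ Δ₀ Γ Δ : List Fm) : Set where
  field
    coverˡ : χ ∈ Γ₀ → CoveredL Γ Δ χ
    coverʳ : χ ∈ Δ₀ → CoveredR Γ Δ χ
open _⇒_≼_⇒_

coveredL-var : ∀ {p} → CoveredL Γ Δ (var p) → var p ∈ Γ
coveredL-var (∈ˡ p∈Γ) = p∈Γ

coveredR-var : ∀ {p} → CoveredR Γ Δ (var p) → var p ∈ Δ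
coveredR-var (∈ʳ p∈Δ) = p∈Δ

coveredL-bot : CoveredL Γ Δ bot → bot ∈ Γ
coveredL-bot (∈ˡ bot∈Γ) = bot∈Γ

coveredL-▷ : CoveredL Γ Δ (a ▷ b) → a ▷ b ∈ Γ
coveredL-▷ (∈ˡ a▷b∈Γ) = a▷b∈Γ

coveredR-▷ : CoveredR Γ Δ (a ▷ b) → a ▷ b ∈ Δ
coveredR-▷ (∈ʳ a▷b∈Δ) = a▷b∈Δ

mutual
  coveredL-≼ : Γ ⇒ Δ ≼ Γ′ ⇒ Δ′ → CoveredL Γ Δ χ → CoveredL Γ′ Δ′ χ
  coveredL-≼ c (∈ˡ χ∈Γ) = coverˡ c χ∈Γ
  coveredL-≼ c (⇒ᶠˡ₁ a) = ⇒ᶠˡ₁ (coveredR-≼ c a)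
  coveredL-≼ c (⇒ᶠˡ₂ b) = ⇒ᶠˡ₂ (coveredL-≼ c b)

  coveredR-≼ : Γ ⇒ Δ ≼ Γ′ ⇒ Δ′ → CoveredR Γ Δ χ → CoveredR Γ′ Δ′ χ
  coveredR-≼ c (∈ʳ χ∈Δ) = coverʳ c χ∈Δ
  coveredR-≼ c botʳ = botʳ
  coveredR-≼ c (⇒ᶠʳ a b) = ⇒ᶠʳ (coveredL-≼ c a) (coveredR-≼ c b)

≼-trans : Γ₀ ⇒ Δ₀ ≼ Γ ⇒ Δ → Γ ⇒ Δ ≼ Γ′ ⇒ Δ′ → Γ₀ ⇒ Δ₀ ≼ Γ′ ⇒ Δ′
≼-trans c c′ = record { coverˡ = coveredL-≼ c′ ∘ coverˡ c ; coverʳ = coveredR-≼ c′ ∘ coverʳ c }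

⊆⇒≼ : Γ ⊆ Γ′ → Δ ⊆ Δ′ → Γ ⇒ Δ ≼ Γ′ ⇒ Δ′
⊆⇒≼ Γ⊆ Δ⊆ = record { coverˡ = ∈ˡ ∘ Γ⊆ ; coverʳ = ∈ʳ ∘ Δ⊆ }

≼-refl : Γ ⇒ Δ ≼ Γ ⇒ Δ
≼-refl = ⊆⇒≼ id id

≼-∷ˡ : CoveredL Γ Δ χ → Γ₀ ⇒ Δ₀ ≼ Γ ⇒ Δ → χ ∷ Γ₀ ⇒ Δ₀ ≼ Γ ⇒ Δ
≼-∷ˡ χ-covered c =
  record { coverˡ = λ { (here refl) → χ-covered ; (there χ∈) → coverˡ c χ∈ } ; coverʳ = coverʳ c }

≼-∷ʳ : CoveredR Γ Δ χ → Γ₀ ⇒ Δ₀ ≼ Γ ⇒ Δ → Γ₀ ⇒ Δ₀ ++ χ ∷ [] ≼ Γ ⇒ Δ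
≼-∷ʳ {Γ} {Δ} {χ} {Δ₀ = Δ₀} χ-covered c = record { coverˡ = coverˡ c ; coverʳ = cover }
  where
  cover : ∀ {ξ} → ξ ∈ Δ₀ ++ χ ∷ [] → CoveredR Γ Δ ξ
  cover m with ∈-++⁻ Δ₀ m
  ... | inj₁ ξ∈Δ₀ = coverʳ c ξ∈Δ₀
  ... | inj₂ (here refl) = χ-covered

≼-impL₁ : Γ ↭ (a ⇒ᶠ b) ∷ G → Γ ⇒ Δ ≼ G ⇒ Δ ++ a ∷ []
≼-impL₁ {Δ = Δ} Γ↭ =
  ≼-trans (⊆⇒≼ (⊆-reflexive-↭ Γ↭) id)
          (≼-∷ˡ (⇒ᶠˡ₁ (∈ʳ (∈-++⁺ʳ Δ (here refl)))) (⊆⇒≼ id (xs⊆xs++ys Δ _)))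

≼-impL₂ : Γ ↭ (a ⇒ᶠ b) ∷ G → Γ ⇒ Δ ≼ b ∷ G ⇒ Δ
≼-impL₂ {b = b} {G = G} Γ↭ =
  ≼-trans (⊆⇒≼ (⊆-reflexive-↭ Γ↭) id)
          (≼-∷ˡ (⇒ᶠˡ₂ (∈ˡ (here refl))) (⊆⇒≼ (xs⊆x∷xs G b) id))

≼-impR : Δ ↭ D ++ (a ⇒ᶠ b) ∷ [] → Γ ⇒ Δ ≼ a ∷ Γ ⇒ D ++ b ∷ []
≼-impR {D = D} {a = a} {Γ = Γ} Δ↭ =
  ≼-trans (⊆⇒≼ id (⊆-reflexive-↭ Δ↭))
          (≼-∷ʳ (⇒ᶠʳ (∈ˡ (here refl)) (∈ʳ (∈-++⁺ʳ D (here refl))))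
                (⊆⇒≼ (xs⊆x∷xs Γ a) (xs⊆xs++ys D _)))

↑_ : (List Fm → List Fm → Set) → List Fm → List Fm → Set
(↑ X) Γ Δ = ∃₂ λ Γ₀ Δ₀ → X Γ₀ Δ₀ × Γ₀ ⇒ Δ₀ ≼ Γ ⇒ Δ

↑-incl : X Γ Δ → (↑ X) Γ Δ
↑-incl x = _ , _ , x , ≼-refl

↑-≼ : (↑ X) Γ Δ → Γ ⇒ Δ ≼ Γ′ ⇒ Δ′ → (↑ X) Γ′ Δ′
↑-≼ (Γ₀ , Δ₀ , x , c) c′ = Γ₀ , Δ₀ , x , ≼-trans c c′

Premise : (List Fm → List Fm → Set) → Fm → Fm → List Fm → Set
Premise Y φ ψ Φ = Y (ψ ∷ ((Φ ++ φ ∷ []) ▷⊥)) (Φ ++ φ ∷ [])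

Premise-↑-mono : ∀ {Φ Φ′} → Φ ⊆ Φ′ → Premise (↑ X) φ ψ Φ → Premise (↑ X) φ ψ Φ′
Premise-↑-mono {φ = φ} {ψ = ψ} {Φ} {Φ′} Φ⊆ p = ↑-≼ p (⊆⇒≼ (∷⁺ʳ ψ (map⁺ (_▷ bot) Φφ⊆)) Φφ⊆)
  where
  Φφ⊆ : Φ ++ φ ∷ [] ⊆ Φ′ ++ φ ∷ []
  Φφ⊆ = ++⁺ˡ (φ ∷ []) Φ⊆

-- The i-th premise receives Φ_[0,i) through i shifts of P, matching the
-- definitional equation prefix φs (suc i) = φs zero ∷ prefix (φs ∘ suc) i.
Premises : (Fm → List Fm → Set) → Fm → List (Fm × Fm) → Set
Premises P ψ [] = P ψ []
Premises P ψ ((a , b) ∷ ps) = P b [] × Premises (λ χ Φ → P χ (a ∷ Φ)) ψ ps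

pairs : (Fin m → Fm) → (Fin (suc m) → Fm) → List (Fm × Fm)
pairs φs ψs = tabulate (λ j → φs j , ψs (inject₁ j))

φsOf : (qs : List (Fm × Fm)) → Fin (length qs) → Fm
φsOf qs = proj₁ ∘ lookup qs

ψsOf : (qs : List (Fm × Fm)) → Fm → Fin (suc (length qs)) → Fm
ψsOf [] ψ _ = ψ
ψsOf (q ∷ qs) ψ zero = proj₂ q
ψsOf (q ∷ qs) ψ (suc i) = ψsOf qs ψ i

ψsOf-last : (qs : List (Fm × Fm)) → ψsOf qs ψ (fromℕ (length qs)) ≡ ψ
ψsOf-last [] = refl
ψsOf-last (q ∷ qs) = ψsOf-last qs

pairs-φsOf-ψsOf : (qs : List (Fm × Fm)) → pairs (φsOf qs) (ψsOf qs ψ) ≡ qs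
pairs-φsOf-ψsOf [] = refl
pairs-φsOf-ψsOf (q ∷ qs) = cong (q ∷_) (pairs-φsOf-ψsOf qs)

principals≡pairs : (φs : Fin m → Fm) (ψs : Fin (suc m) → Fm) →
                   map (λ j → φs j ▷ ψs (inject₁ j)) (allFin m) ≡ map (uncurry _▷_) (pairs φs ψs)
principals≡pairs φs ψs =
  trans (map-tabulate id (λ j → φs j ▷ ψs (inject₁ j)))
        (sym (map-tabulate (λ j → φs j , ψs (inject₁ j)) (uncurry _▷_)))

φsOf-injective : {qs : List (Fm × Fm)} → AllPairs (_≢_ on proj₁) qs → Injective _≡_ _≡_ (φsOf qs)
φsOf-injective {_ ∷ _} _ {zero} {zero} _ = refl
φsOf-injective {_ ∷ qs} (q≢ ∷ _) {zero} {suc j} eq = ⊥-elim (All.lookup q≢ (∈-lookup j) eq)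
φsOf-injective {_ ∷ qs} (q≢ ∷ _) {suc i} {zero} eq = ⊥-elim (All.lookup q≢ (∈-lookup i) (sym eq))
φsOf-injective {_ ∷ _} (_ ∷ distinct) {suc i} {suc j} eq = cong suc (φsOf-injective distinct eq)

Premises-pairs : {P : Fm → List Fm → Set} (φs : Fin m → Fm) (ψs : Fin (suc m) → Fm) →
                 (∀ i → P (ψs i) (prefix φs i)) → Premises P (ψs (fromℕ m)) (pairs φs ψs)
Premises-pairs {zero} φs ψs ps = ps zero
Premises-pairs {suc m} {P} φs ψs ps =
  ps zero , Premises-pairs {P = λ χ Φ → P χ (φs zero ∷ Φ)} (φs ∘ suc) (ψs ∘ suc) (ps ∘ suc)

Premises-lookup : {P : Fm → List Fm → Set} (qs : List (Fm × Fm)) →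
                  Premises P ψ qs → ∀ i → P (ψsOf qs ψ i) (prefix (φsOf qs) i)
Premises-lookup [] p zero = p
Premises-lookup (q ∷ qs) (p , _) zero = p
Premises-lookup {P = P} (q ∷ qs) (_ , ps) (suc i) =
  Premises-lookup {P = λ χ Φ → P χ (proj₁ q ∷ Φ)} qs ps i

dedupFst : List Fm → List (Fm × Fm) → List (Fm × Fm)
dedupFst seen [] = []
dedupFst seen ((a , b) ∷ ps) with a ∈? seen
... | yes _ = dedupFst seen ps
... | no _ = (a , b) ∷ dedupFst (a ∷ seen) ps

dedupFst-⊆ : ∀ seen ps → dedupFst seen ps ⊆ ps
dedupFst-⊆ seen ((a , b) ∷ ps) q∈ with a ∈? seen | q∈
... | yes _ | q∈′ = there (dedupFst-⊆ seen ps q∈′)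
... | no _ | here q≡ = here q≡
... | no _ | there q∈′ = there (dedupFst-⊆ (a ∷ seen) ps q∈′)

dedupFst-fresh : ∀ seen ps {q} → q ∈ dedupFst seen ps → proj₁ q ∉ seen
dedupFst-fresh seen ((a , b) ∷ ps) q∈ with a ∈? seen | q∈
... | yes _ | q∈′ = dedupFst-fresh seen ps q∈′
... | no a∉ | here refl = a∉
... | no _ | there q∈′ = dedupFst-fresh (a ∷ seen) ps q∈′ ∘ there

dedupFst-distinct : ∀ seen ps → AllPairs (_≢_ on proj₁) (dedupFst seen ps)
dedupFst-distinct seen [] = []
dedupFst-distinct seen ((a , b) ∷ ps) with a ∈? seen
... | yes _ = dedupFst-distinct seen ps
... | no _ = All.tabulate (λ q∈ a≡ → dedupFst-fresh (a ∷ seen) ps q∈ (here (sym a≡)))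
           ∷ dedupFst-distinct (a ∷ seen) ps

dedupFst-Premises : ∀ seen ps {P Q : Fm → List Fm → Set} →
                    (∀ {χ Φ Φ′} → Φ ⊆ seen ++ Φ′ → P χ Φ → Q χ Φ′) →
                    Premises P ψ ps → Premises Q ψ (dedupFst seen ps)
dedupFst-Premises seen [] P⇒Q p = P⇒Q (λ ()) p
dedupFst-Premises seen ((a , b) ∷ ps) {P} {Q} P⇒Q (p , ps′) with a ∈? seen
... | yes a∈ = dedupFst-Premises seen ps {λ χ Φ → P χ (a ∷ Φ)} {Q}
                 (λ Φ⊆ → P⇒Q (∈-∷⁺ʳ (∈-++⁺ˡ a∈) Φ⊆)) ps′
... | no _ = P⇒Q (λ ()) p ,
             dedupFst-Premises (a ∷ seen) ps {λ χ Φ → P χ (a ∷ Φ)} {λ χ Φ → Q χ (a ∷ Φ)}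
               (λ {_} {Φ} {Φ′} Φ⊆ → P⇒Q (∈-∷⁺ʳ (∈-++⁺ʳ seen (here refl))
                                          (⊆-reflexive-↭ (↭-sym (shift a seen Φ′)) ∘ Φ⊆))) ps′

modal-slim : (qs : List (Fm × Fm)) → AllPairs (_≢_ on proj₁) qs →
             map (uncurry _▷_) qs ⊆ Γ → ψ ▷ φ ∈ Δ → Premises (Premise Y φ) ψ qs → Local slim Y Γ Δ
modal-slim {Γ = Γ} {ψ = ψ} {φ = φ} {Δ = Δ} qs distinct boxes⊆Γ ψ▷φ∈Δ ps
  with G , Γ↭ ← Unique-⊆⇒↭++ (AllPairsₚ.map⁺ (AllPairs.map (_∘ ▷-injectiveˡ) distinct)) boxes⊆Γ
  with D , Δ↭ ← ∈⇒↭ ψ▷φ∈Δ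
  = modal G D (length qs) (φsOf qs) (ψsOf qs ψ) φ (φsOf-injective distinct)
      (↭-trans Γ↭ (↭-reflexive (cong (_++ G) (sym principals≡qs))))
      (↭-trans Δ↭ (↭-reflexive (cong (λ ψ′ → ψ′ ▷ φ ∷ D) (sym (ψsOf-last qs)))))
      (Premises-lookup qs ps)
  where
  principals≡qs : map (λ j → φsOf qs j ▷ ψsOf qs ψ (inject₁ j)) (allFin (length qs))
                  ≡ map (uncurry _▷_) qs
  principals≡qs = trans (principals≡pairs (φsOf qs) (ψsOf qs ψ))
                        (cong (map (uncurry _▷_)) (pairs-φsOf-ψsOf qs))

SlimAbove : (List Fm → List Fm → Set) → List Fm → List Fm → Set
SlimAbove X Γ₀ Δ₀ = ∀ {Γ Δ} → Γ₀ ⇒ Δ₀ ≼ Γ ⇒ Δ → Local slim (↑ X) Γ Δ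

ax-above : ∀ p → Γ₀ ↭ var p ∷ G → Δ₀ ↭ var p ∷ D → SlimAbove X Γ₀ Δ₀
ax-above p Γ₀↭ Δ₀↭ c
  with G , Γ↭ ← ∈⇒↭ (coveredL-var (coverˡ c (∈-resp-↭ (↭-sym Γ₀↭) (here refl))))
  with D , Δ↭ ← ∈⇒↭ (coveredR-var (coverʳ c (∈-resp-↭ (↭-sym Δ₀↭) (here refl))))
  = ax G D p Γ↭ Δ↭

botL-above : Γ₀ ↭ bot ∷ G → SlimAbove X Γ₀ Δ₀
botL-above Γ₀↭ c
  with G , Γ↭ ← ∈⇒↭ (coveredL-bot (coverˡ c (∈-resp-↭ (↭-sym Γ₀↭) (here refl))))
  = botL G Γ↭

botR-above : Δ₀ ↭ bot ∷ D → SlimAbove X Γ₀ D → SlimAbove X Γ₀ Δ₀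
botR-above Δ₀↭ above c = above (≼-trans (⊆⇒≼ id (↭∷⇒⊇ Δ₀↭)) c)

impL-above : Γ₀ ↭ (a ⇒ᶠ b) ∷ G → SlimAbove X G (Δ₀ ++ a ∷ []) → SlimAbove X (b ∷ G) Δ₀ →
             SlimAbove X Γ₀ Δ₀
impL-above {a = a} {b = b} {G = G} {X = X} {Δ₀ = Δ₀} Γ₀↭ above₁ above₂ {Γ} {Δ} c =
  by-cover (coverˡ c (∈-resp-↭ (↭-sym Γ₀↭) (here refl)))
  where
  c′ : G ⇒ Δ₀ ≼ Γ ⇒ Δ
  c′ = ≼-trans (⊆⇒≼ (↭∷⇒⊇ Γ₀↭) id) c

  by-cover : CoveredL Γ Δ (a ⇒ᶠ b) → Local slim (↑ X) Γ Δ
  by-cover (⇒ᶠˡ₁ a-covered) = above₁ (≼-∷ʳ a-covered c′)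
  by-cover (⇒ᶠˡ₂ b-covered) = above₂ (≼-∷ˡ b-covered c′)
  by-cover (∈ˡ a⇒b∈Γ) with G′ , Γ↭ ← ∈⇒↭ a⇒b∈Γ =
    impL G′ a b Γ↭
      (above₁ (≼-∷ʳ (∈ʳ (∈-++⁺ʳ Δ (here refl))) (≼-trans c′ (≼-impL₁ Γ↭))))
      (above₂ (≼-∷ˡ (∈ˡ (here refl)) (≼-trans c′ (≼-impL₂ Γ↭))))

impR-above : Δ₀ ↭ D ++ (a ⇒ᶠ b) ∷ [] → SlimAbove X (a ∷ Γ₀) (D ++ b ∷ []) → SlimAbove X Γ₀ Δ₀
impR-above {D = D} {a = a} {b = b} {X = X} {Γ₀ = Γ₀} Δ₀↭ above {Γ} {Δ} c =
  by-cover (coverʳ c (∈-resp-↭ (↭-sym Δ₀↭) (∈-++⁺ʳ D (here refl))))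
  where
  c′ : Γ₀ ⇒ D ≼ Γ ⇒ Δ
  c′ = ≼-trans (⊆⇒≼ id (↭++⇒⊇ Δ₀↭)) c

  by-cover : CoveredR Γ Δ (a ⇒ᶠ b) → Local slim (↑ X) Γ Δ
  by-cover (⇒ᶠʳ a-covered b-covered) = above (≼-∷ˡ a-covered (≼-∷ʳ b-covered c′))
  by-cover (∈ʳ a⇒b∈Δ) with D′ , Δ↭ ← ∈⇒↭∷ʳ a⇒b∈Δ =
    impR D′ a b Δ↭
      (above (≼-∷ˡ (∈ˡ (here refl)) (≼-∷ʳ (∈ʳ (∈-++⁺ʳ D′ (here refl))) (≼-trans c′ (≼-impR Δ↭)))))

boxes-covered : (ps : List (Fm × Fm)) → Γ₀ ⇒ Δ₀ ≼ Γ ⇒ Δ →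
                map (uncurry _▷_) ps ⊆ Γ₀ → map (uncurry _▷_) ps ⊆ Γ
boxes-covered ps c boxes⊆Γ₀ χ∈ with _ , _ , refl ← ∈-map⁻ (uncurry _▷_) χ∈ =
  coveredL-▷ (coverˡ c (boxes⊆Γ₀ χ∈))

modal-above : (φs : Fin m → Fm) (ψs : Fin (suc m) → Fm) →
              Γ₀ ↭ map (λ j → φs j ▷ ψs (inject₁ j)) (allFin m) ++ G →
              Δ₀ ↭ (ψs (fromℕ m) ▷ φ) ∷ D →
              (∀ i → Premise X φ (ψs i) (prefix φs i)) → SlimAbove X Γ₀ Δ₀
modal-above {Γ₀ = Γ₀} φs ψs Γ₀↭ Δ₀↭ premises c =
  modal-slim (dedupFst [] ps) (dedupFst-distinct [] ps)
    (boxes-covered ps c boxes⊆Γ₀ ∘ map⁺ (uncurry _▷_) (dedupFst-⊆ [] ps))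
    (coveredR-▷ (coverʳ c (∈-resp-↭ (↭-sym Δ₀↭) (here refl))))
    (dedupFst-Premises [] ps Premise-↑-mono (Premises-pairs φs ψs (↑-incl ∘ premises)))
  where
  ps : List (Fm × Fm)
  ps = pairs φs ψs

  boxes⊆Γ₀ : map (uncurry _▷_) ps ⊆ Γ₀
  boxes⊆Γ₀ rewrite sym (principals≡pairs φs ψs) = ↭++⇒⊇ Γ₀↭

slimAbove : Local full X Γ₀ Δ₀ → SlimAbove X Γ₀ Δ₀
slimAbove (ax _ _ p Γ₀↭ Δ₀↭) = ax-above p Γ₀↭ Δ₀↭
slimAbove (botL _ Γ₀↭) = botL-above Γ₀↭
slimAbove (botR _ Δ₀↭ d) = botR-above Δ₀↭ (slimAbove d)
slimAbove (impL _ _ _ Γ₀↭ d₁ d₂) = impL-above Γ₀↭ (slimAbove d₁) (slimAbove d₂)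
slimAbove (impR _ _ _ Δ₀↭ d) = impR-above Δ₀↭ (slimAbove d)
slimAbove (modal _ _ _ φs ψs _ _ Γ₀↭ Δ₀↭ premises) = modal-above φs ψs Γ₀↭ Δ₀↭ premises

mainTheorem9 : (Γ Δ : List Fm) → G∞⊢ Γ Δ → G∞slim⊢ Γ Δ
mainTheorem9 Γ Δ (X , local , x) =
  ↑ X , (λ { _ _ (Γ₀ , Δ₀ , x₀ , c) → slimAbove (local Γ₀ Δ₀ x₀) c }) , ↑-incl x
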